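{- Let $M$ be a $\lambda$-term that is normalizable for $\to^{\neg e}_\epsilon$. Then there exists $s\in T(M)$ such that the support of $NF^{\neg e}_\epsilon(s)$ contains a positive resource term.
   Context: $\lambda$-calculus: $\to^{\neg e}$ is the contextual closure of $(\lambda x.M)N\to M[N/x]$ when $x\in FV(M)$; $\to_\sigma$ is the contextual closure of $((\lambda x.M)N)P\to(\lambda x.MP)N$ when $x\notin FV(P)$; $\to^{\neg e}_\epsilon=\to^{\neg e}\cup\to_\sigma$; $M$ is normalizable for it if it reduces in finitely many steps to a term with no reduct. Resource terms $s::=x\mid\lambda x.s\mid\langle s\rangle\bar t$, $\bar t=[t_1,\dots,t_n]$ a finite multiset (up to $\alpha$); finite formal sums with $\mathbb N$ coefficients ($0$ the empty sum), constructors extended multilinearly, support = terms with nonzero coefficient. $\partial_x s\cdot[u_1,\dots,u_n]=\sum_{\pi\in\mathfrak S_n}s[u_{\pi(1)}/x_1,\dots,u_{\pi(n)}/x_n]$ if $x_1,\dots,x_n$ enumerate the free occurrences of $x$ in $s$ (exactly $n$), else $0$. Taylor expansion: $T(x)=\{x\}$, $T(\lambda x.M)=\{\lambda x.s\mid s\in T(M)\}$, $T(PQ)=\{\langle s\rangle[t_1,\dots,t_n]\mid s\in T(P),n\ge0,t_i\in T(Q)\}$. $\to^{\neg e}_\partial$: $\langle\lambda x.s\rangle\bar t\to\partial_x s\cdot\bar t$ if $x\in FV(s)$; $\to_{\partial\sigma}$: $\langle\langle\lambda x.s\rangle\bar t\rangle\bar q\to\langle\lambda x.\langle s\rangle\bar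 q\rangle\bar t$ if $x\notin FV(\bar q)$; both closed under contexts and on sums by reducing one summand; $\to^{\neg e}_{\partial\epsilon}$ is their union, confluent and strongly normalizing, and $NF^{\neg e}_\epsilon(s)$ is the normal form of $s$ (a finite sum). Positive resource terms: $x$; $\lambda x.s$ with $s$ positive; $\langle s\rangle[t_1,\dots,t_n]$ with $n\ge1$ and $s,t_i$ positive. -}

module Defs where

-- Conventions: de Bruijn indices (so alpha-equivalence is syntactic equality).
-- Bags [t1,...,tn] are lists; formal sums with ℕ coefficients are lists of
-- resource terms (a term with coefficient k occurs k times; 0 is []).

open import Data.Nat using (ℕ; zero; suc; _+_; _∸_; _<_; _<ᵇ_; _≡ᵇ_)
open import Data.Bool using (Bool; true; false; if_then_else_)
open import Data.List using (List; []; _∷_; _++_; map; concatMap; length)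
open import Data.List.Relation.Unary.All using (All)
open import Data.List.Membership.Propositional using (_∈_)
open import Data.Product using (_×_; _,_; proj₁; Σ; ∃)
open import Relation.Nullary using (¬_)
open import Relation.Binary.Construct.Closure.ReflexiveTransitive using (Star)

data Λ : Set where
  var : ℕ → Λ
  lam : Λ → Λ
  app : Λ → Λ → Λ

countΛ : ℕ → Λ → ℕ
countΛ k (var n) = if n ≡ᵇ k then 1 else 0
countΛ k (lam M) = countΛ (suc k) M
countΛ k (app M N) = countΛ k M + countΛ k N

liftΛ : ℕ → ℕ → Λ → Λ
liftΛ c d (var n) = if n <ᵇ c then var n else var (n + d)
liftΛ c d (lam M) = lam (liftΛ (suc c) d M)
liftΛ c d (app M N) = app (liftΛ c d M) (liftΛ c d N)

-- substΛ d N M : M[N/x] where x is index d in M (M under d extra binders);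
-- the binder of x is removed, so indices above d are decremented.
substΛ : ℕ → Λ → Λ → Λ
substΛ d N (var n) =
  if n <ᵇ d then var n else (if n ≡ᵇ d then liftΛ 0 d N else var (n ∸ 1))
substΛ d N (lam M) = lam (substΛ (suc d) N M)
substΛ d N (app M M') = app (substΛ d N M) (substΛ d N M')

-- one step of →^{¬e}_ε = →^{¬e} ∪ →_σ (contextual closure)
data _⟶ε_ : Λ → Λ → Set where
  β¬e  : ∀ {M N} → 0 < countΛ 0 M → app (lam M) N ⟶ε substΛ 0 N M
  σ    : ∀ {M N P} → app (app (lam M) N) P ⟶ε app (lam (app M (liftΛ 0 1 P))) N
  ξlam : ∀ {M M'} → M ⟶ε M' → lam M ⟶ε lam M'
  ξappL : ∀ {M M' N} → M ⟶ε M' → app M N ⟶ε app M' N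
  ξappR : ∀ {M N N'} → N ⟶ε N' → app M N ⟶ε app M N'

_⟶ε*_ : Λ → Λ → Set
_⟶ε*_ = Star _⟶ε_

NormalΛ : Λ → Set
NormalΛ M = ∀ M' → ¬ (M ⟶ε M')

Normalizable : Λ → Set
Normalizable M = Σ Λ λ N → (M ⟶ε* N) × NormalΛ N

data RTerm : Set where
  var : ℕ → RTerm
  lam : RTerm → RTerm
  app : RTerm → List RTerm → RTerm

Bag : Set
Bag = List RTerm

Sum : Set
Sum = List RTerm

mutual
  count : ℕ → RTerm → ℕ
  count k (var n) = if n ≡ᵇ k then 1 else 0
  count k (lam s) = count (suc k) s
  count k (app s ts) = count k s + countBag k ts

  countBag : ℕ → Bag → ℕ
  countBag k [] = 0
  countBag k (t ∷ ts) = count k t + countBag k ts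

mutual
  lift : ℕ → ℕ → RTerm → RTerm
  lift c d (var n) = if n <ᵇ c then var n else var (n + d)
  lift c d (lam s) = lam (lift (suc c) d s)
  lift c d (app s ts) = app (lift c d s) (liftBag c d ts)

  liftBag : ℕ → ℕ → Bag → Bag
  liftBag c d [] = []
  liftBag c d (t ∷ ts) = lift c d t ∷ liftBag c d ts

-- fill d s us : replace the free occurrences of the variable of index d in s,
-- enumerated left to right, by the successive elements of us (removing the
-- binder of that variable); returns the result and the unused elements.
mutual
  fill : ℕ → RTerm → List RTerm → RTerm × List RTerm
  fill d (var n) us with n <ᵇ d | n ≡ᵇ d | us
  ... | true  | _     | us'       = var n , us'
  ... | false | true  | []        = var n , []
  ... | false | true  | u ∷ us'   = lift 0 d u , us'
  ... | false | false | us'       = var (n ∸ 1) , us'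
  fill d (lam s) us with fill (suc d) s us
  ... | s' , us' = lam s' , us'
  fill d (app s ts) us with fill d s us
  ... | s' , us₁ with fillBag d ts us₁
  ...   | ts' , us₂ = app s' ts' , us₂

  fillBag : ℕ → Bag → List RTerm → Bag × List RTerm
  fillBag d [] us = [] , us
  fillBag d (t ∷ ts) us with fill d t us
  ... | t' , us₁ with fillBag d ts us₁
  ...   | ts' , us₂ = t' ∷ ts' , us₂

insertions : {A : Set} → A → List A → List (List A)
insertions x [] = (x ∷ []) ∷ []
insertions x (y ∷ ys) = (x ∷ y ∷ ys) ∷ map (y ∷_) (insertions x ys)

-- the n! orderings [u_{π(1)},...,u_{π(n)}], π ∈ 𝔖_n (with multiplicity)
perms : {A : Set} → List A → List (List A)
perms [] = [] ∷ []
perms (x ∷ xs) = concatMap (insertions x) (perms xs)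

-- ∂_x s · [u1,...,un] with x the de Bruijn variable 0 of s
∂ : RTerm → Bag → Sum
∂ s us = if count 0 s ≡ᵇ length us
         then map (λ π → proj₁ (fill 0 s π)) (perms us)
         else []

-- one step  s → S  of →^{¬e}_∂ ∪ →_{∂σ}, closed under contexts (multilinearly)
data _⇒_ : RTerm → Sum → Set where
  ∂β¬e : ∀ {s ts} → 0 < count 0 s → app (lam s) ts ⇒ ∂ s ts
  ∂σ   : ∀ {s ts qs} →
         app (app (lam s) ts) qs ⇒ (app (lam (app s (liftBag 0 1 qs))) ts ∷ [])
  ξlam : ∀ {s S} → s ⇒ S → lam s ⇒ map lam S
  ξappL : ∀ {s S ts} → s ⇒ S → app s ts ⇒ map (λ s' → app s' ts) S
  ξbag : ∀ {s t S ts₁ ts₂} → t ⇒ S →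
         app s (ts₁ ++ t ∷ ts₂) ⇒ map (λ t' → app s (ts₁ ++ t' ∷ ts₂)) S

data _⟶∂_ : Sum → Sum → Set where
  step : ∀ {S₁ s S S₂} → s ⇒ S → (S₁ ++ s ∷ S₂) ⟶∂ (S₁ ++ S ++ S₂)

_⟶∂*_ : Sum → Sum → Set
_⟶∂*_ = Star _⟶∂_

NormalSum : Sum → Set
NormalSum S = ∀ S' → ¬ (S ⟶∂ S')

data _∈T_ : RTerm → Λ → Set where
  tvar : ∀ {n} → var n ∈T var n
  tlam : ∀ {s M} → s ∈T M → lam s ∈T lam M
  tapp : ∀ {s ts P Q} → s ∈T P → All (_∈T Q) ts → app s ts ∈T app P Q

data Positive : RTerm → Set where
  pvar : ∀ {n} → Positive (var n)
  plam : ∀ {s} → Positive s → Positive (lam s)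
  papp : ∀ {s t ts} → Positive s → Positive t → All Positive ts →
         Positive (app s (t ∷ ts))

-- "the support of NF^{¬e}_ε(s) contains a positive resource term":
-- s reduces to a normal sum whose support contains a positive term
-- (the normal form is unique by confluence + strong normalization).
NFHasPositive : RTerm → Set
NFHasPositive s = Σ Sum λ S → ((s ∷ []) ⟶∂* S) × NormalSum S ×
                  ∃ λ t → t ∈ S × Positive t

module Submission where

-- Let M ⟶ε* N with N normal.  The linearisation  lin N  (every
-- argument bag a singleton) is a positive element of T(N), and a normal
-- resource term since its resource redexes come from redexes of N.  We pull
-- it back along the reduction by anti-reduction: if M ⟶ε M' and t' ∈ T(M')
-- is positive, some positive t ∈ T(M) reduces to a sum containing t'.  For a
-- β-step this uses the decomposition of a positive element of T(A[N/x]) as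
-- a[ū/x] with a ∈ T(A), ū ⊆ T(N) positive and |ū| = occurrences of x in a;
-- σ-steps and context rules are direct.  Finally resource reduction is weakly
-- normalising (β lowers the size, σ keeps it and lowers a multiplicative
-- weight), so the other summands around  lin N  can be normalised.

open import Defs
open import Data.Nat
open import Data.Nat.Properties
open import Data.Nat.Induction using (<-wellFounded)
open import Data.Nat.Tactic.RingSolver using (solve-∀)
open import Induction.WellFounded using (WellFounded; Acc; acc)
open import Relation.Binary.Construct.On as On using ()
open import Data.Bool using (true; false; if_then_else_; T)
open import Data.Bool.Properties using (T-≡)
open import Function.Bundles using (Equivalence)
open import Data.List using (List; []; _∷_; _++_; map; length)
open import Data.List.Properties using (map-++; ++-assoc; ++-identityʳ; length-++)
open import Data.List.Relation.Unary.All as All using (All; []; _∷_)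
open import Data.List.Relation.Unary.All.Properties using (map⁺; ++⁺)
open import Data.List.Relation.Unary.Any using (here; there)
open import Data.List.Membership.Propositional using (_∈_)
open import Data.List.Membership.Propositional.Properties
  using (∈-++⁺ˡ; ∈-++⁺ʳ; ∈-map⁺; ∈-map⁻; ∈-concat⁺′; ∈-concat⁻′; ∈-∃++)
open import Data.Product using (_×_; _,_; proj₁; proj₂; Σ)
open import Data.Product.Relation.Binary.Lex.Strict using (×-Lex; ×-wellFounded)
open import Data.Sum using (_⊎_; inj₁; inj₂)
open import Data.Empty using (⊥; ⊥-elim)
open import Data.Unit using (⊤; tt)
open import Relation.Nullary using (¬_; Dec; yes; no)
open import Relation.Binary.PropositionalEquality
open import Relation.Binary.Construct.Closure.ReflexiveTransitive using (ε; _◅_; _◅◅_)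

⟶∂-++ˡ : ∀ A {S S'} → S ⟶∂ S' → (A ++ S) ⟶∂ (A ++ S')
⟶∂-++ˡ A (step {S₁} {s} {S} {S₂} r) =
  subst₂ _⟶∂_ (++-assoc A S₁ (s ∷ S₂)) (++-assoc A S₁ (S ++ S₂))
    (step {A ++ S₁} {s} {S} {S₂} r)

⟶∂-++ʳ : ∀ B {S S'} → S ⟶∂ S' → (S ++ B) ⟶∂ (S' ++ B)
⟶∂-++ʳ B (step {S₁} {s} {S} {S₂} r) =
  subst₂ _⟶∂_ (sym (++-assoc S₁ (s ∷ S₂) B))
    (trans (cong (S₁ ++_) (sym (++-assoc S S₂ B))) (sym (++-assoc S₁ (S ++ S₂) B)))
    (step {S₁} {s} {S} {S₂ ++ B} r)

⟶∂*-++ : ∀ {A A' B B'} → A ⟶∂* A' → B ⟶∂* B' → (A ++ B) ⟶∂* (A' ++ B')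
⟶∂*-++ ε ε = ε
⟶∂*-++ {A = A} ε (r ◅ rs) = ⟶∂-++ˡ A r ◅ ⟶∂*-++ ε rs
⟶∂*-++ {B = B} (r ◅ rs) rsB = ⟶∂-++ʳ B r ◅ ⟶∂*-++ rs rsB

ReductionContext : (RTerm → RTerm) → Set
ReductionContext C = ∀ {x X} → x ⇒ X → C x ⇒ map C X

⟶∂*-map : ∀ {C} → ReductionContext C → ∀ {S S'} → S ⟶∂* S' → map C S ⟶∂* map C S'
⟶∂*-map ξC ε = ε
⟶∂*-map {C} ξC (step {S₁} {s} {S} {S₂} r ◅ rs) =
  subst₂ _⟶∂_ (sym (map-++ C S₁ (s ∷ S₂)))
    (sym (trans (map-++ C S₁ (S ++ S₂)) (cong (map C S₁ ++_) (map-++ C S S₂))))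
    (step {map C S₁} {C s} {map C S} {map C S₂} (ξC r))
  ◅ ⟶∂*-map ξC rs

single : ∀ {s S} → s ⇒ S → (s ∷ []) ⟶∂* S
single {s} {S} r = subst ((s ∷ []) ⟶∂_) (++-identityʳ S) (step {[]} {s} {S} {[]} r) ◅ ε

Reach : RTerm → RTerm → Set
Reach s t = Σ Sum λ S → ((s ∷ []) ⟶∂* S) × t ∈ S

reach-refl : ∀ {s} → Reach s s
reach-refl = _ , ε , here refl

reach-trans : ∀ {s t u} → Reach s t → Reach t u → Reach s u
reach-trans (S , r , t∈S) (U , r' , u∈U) with ∈-∃++ t∈S
... | A , B , refl = A ++ U ++ B , r ◅◅ ⟶∂*-++ (ε {x = A}) (⟶∂*-++ r' ε) , ∈-++⁺ʳ A (∈-++⁺ˡ u∈U)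

reach-map : ∀ {C} → ReductionContext C → ∀ {s t} → Reach s t → Reach (C s) (C t)
reach-map {C} ξC (S , r , t∈S) = map C S , ⟶∂*-map ξC r , ∈-map⁺ C t∈S

NormalT : RTerm → Set
NormalT t = ∀ S → ¬ (t ⇒ S)

normalSum : ∀ {S} → All NormalT S → NormalSum S
normalSum normals S' (step {S₁} {s} {S₀} {S₂} r) =
  All.lookup normals (∈-++⁺ʳ S₁ (here refl)) S₀ r

-- RootRedex s : every application  ⟨s⟩ts  is a redex at the root.
RootRedex : RTerm → Set
RootRedex (var n) = ⊥
RootRedex (lam s) = 0 < count 0 s
RootRedex (app (var n) _) = ⊥
RootRedex (app (lam _) _) = ⊤
RootRedex (app (app _ _) _) = ⊥

rootRedex? : ∀ s → Dec (RootRedex s)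
rootRedex? (var n) = no λ ()
rootRedex? (lam s) = 0 <? count 0 s
rootRedex? (app (var n) _) = no λ ()
rootRedex? (app (lam _) _) = yes tt
rootRedex? (app (app _ _) _) = no λ ()

fireRoot : ∀ s ts → RootRedex s → Σ Sum (app s ts ⇒_)
fireRoot (lam s) ts c = _ , ∂β¬e c
fireRoot (app (lam s) ts') ts _ = _ , ∂σ

appStepCases : ∀ {s ts S} → app s ts ⇒ S →
  RootRedex s ⊎ Σ Sum (s ⇒_) ⊎ Σ RTerm λ t → t ∈ ts × Σ Sum (t ⇒_)
appStepCases (∂β¬e c) = inj₁ c
appStepCases ∂σ = inj₁ tt
appStepCases (ξappL r) = inj₂ (inj₁ (_ , r))
appStepCases (ξbag {ts₁ = ts₁} r) = inj₂ (inj₂ (_ , ∈-++⁺ʳ ts₁ (here refl) , _ , r))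

mutual
  progress : ∀ s → Σ Sum (s ⇒_) ⊎ NormalT s
  progress (var n) = inj₂ λ S ()
  progress (lam s) with progress s
  ... | inj₁ (S , r) = inj₁ (_ , ξlam r)
  ... | inj₂ ns = inj₂ λ { S (ξlam r) → ns _ r }
  progress (app s ts) with rootRedex? s | progress s | progressBag ts
  ... | yes root | _ | _ = inj₁ (fireRoot s ts root)
  ... | no _ | inj₁ (S , r) | _ = inj₁ (_ , ξappL r)
  ... | no _ | inj₂ _ | inj₁ (ts₁ , t , ts₂ , refl , S , r) = inj₁ (_ , ξbag {ts₁ = ts₁} r)
  ... | no ¬root | inj₂ ns | inj₂ nts = inj₂ λ S r → noStep (appStepCases r)
    where
    noStep : RootRedex s ⊎ Σ Sum (s ⇒_) ⊎ Σ RTerm (λ t → t ∈ ts × Σ Sum (t ⇒_)) → ⊥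
    noStep (inj₁ root) = ¬root root
    noStep (inj₂ (inj₁ (_ , r))) = ns _ r
    noStep (inj₂ (inj₂ (t , t∈ts , _ , r))) = All.lookup nts t∈ts _ r

  progressBag : ∀ ts →
    (Σ Bag λ ts₁ → Σ RTerm λ t → Σ Bag λ ts₂ → ts ≡ ts₁ ++ t ∷ ts₂ × Σ Sum (t ⇒_))
    ⊎ All NormalT ts
  progressBag [] = inj₂ []
  progressBag (t ∷ ts) with progress t | progressBag ts
  ... | inj₁ st | _ = inj₁ ([] , t , ts , refl , st)
  ... | inj₂ _ | inj₁ (ts₁ , u , ts₂ , refl , su) = inj₁ (t ∷ ts₁ , u , ts₂ , refl , su)
  ... | inj₂ nt | inj₂ nts = inj₂ (nt ∷ nts)

-- Termination of resource reduction

mutual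
  size : RTerm → ℕ
  size (var n) = 1
  size (lam s) = suc (size s)
  size (app s ts) = suc (size s + sizeBag ts)

  sizeBag : Bag → ℕ
  sizeBag [] = 0
  sizeBag (t ∷ ts) = size t + sizeBag ts

-- A weight that σ-steps decrease: a bag weighs on its head multiplicatively,
-- so moving the bag qs from outside to inside the abstraction lowers it.
mutual
  weight : RTerm → ℕ
  weight (var n) = 2
  weight (lam s) = suc (weight s)
  weight (app s ts) = suc (weight s * (2 + weightBag ts))

  weightBag : Bag → ℕ
  weightBag [] = 0
  weightBag (t ∷ ts) = weight t + weightBag ts

weight-nonZero : ∀ s → NonZero (weight s)
weight-nonZero (var n) = _
weight-nonZero (lam s) = _
weight-nonZero (app s ts) = _

mutual
  size-lift : ∀ c d s → size (lift c d s) ≡ size s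
  size-lift c d (var n) with n <ᵇ c
  ... | true = refl
  ... | false = refl
  size-lift c d (lam s) = cong suc (size-lift (suc c) d s)
  size-lift c d (app s ts) =
    cong₂ (λ a b → suc (a + b)) (size-lift c d s) (sizeBag-lift c d ts)

  sizeBag-lift : ∀ c d ts → sizeBag (liftBag c d ts) ≡ sizeBag ts
  sizeBag-lift c d [] = refl
  sizeBag-lift c d (t ∷ ts) = cong₂ _+_ (size-lift c d t) (sizeBag-lift c d ts)

mutual
  weight-lift : ∀ c d s → weight (lift c d s) ≡ weight s
  weight-lift c d (var n) with n <ᵇ c
  ... | true = refl
  ... | false = refl
  weight-lift c d (lam s) = cong suc (weight-lift (suc c) d s)
  weight-lift c d (app s ts) =
    cong₂ (λ a b → suc (a * (2 + b))) (weight-lift c d s) (weightBag-lift c d ts)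

  weightBag-lift : ∀ c d ts → weightBag (liftBag c d ts) ≡ weightBag ts
  weightBag-lift c d [] = refl
  weightBag-lift c d (t ∷ ts) = cong₂ _+_ (weight-lift c d t) (weightBag-lift c d ts)

sizeBag-split : ∀ ts₁ t ts₂ → sizeBag (ts₁ ++ t ∷ ts₂) ≡ size t + (sizeBag ts₁ + sizeBag ts₂)
sizeBag-split [] t ts₂ = refl
sizeBag-split (u ∷ ts₁) t ts₂ = begin
  size u + sizeBag (ts₁ ++ t ∷ ts₂)            ≡⟨ cong (size u +_) (sizeBag-split ts₁ t ts₂) ⟩
  size u + (size t + (sizeBag ts₁ + sizeBag ts₂)) ≡⟨ rearrange (size u) (size t) (sizeBag ts₁) (sizeBag ts₂) ⟩
  size t + ((size u + sizeBag ts₁) + sizeBag ts₂) ∎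
  where
  open ≡-Reasoning
  rearrange : ∀ a b c d → a + (b + (c + d)) ≡ b + ((a + c) + d)
  rearrange = solve-∀

weightBag-split : ∀ ts₁ t ts₂ →
  weightBag (ts₁ ++ t ∷ ts₂) ≡ weight t + (weightBag ts₁ + weightBag ts₂)
weightBag-split [] t ts₂ = refl
weightBag-split (u ∷ ts₁) t ts₂ = begin
  weight u + weightBag (ts₁ ++ t ∷ ts₂) ≡⟨ cong (weight u +_) (weightBag-split ts₁ t ts₂) ⟩
  weight u + (weight t + (weightBag ts₁ + weightBag ts₂))
    ≡⟨ rearrange (weight u) (weight t) (weightBag ts₁) (weightBag ts₂) ⟩
  weight t + ((weight u + weightBag ts₁) + weightBag ts₂) ∎
  where
  open ≡-Reasoning
  rearrange : ∀ a b c d → a + (b + (c + d)) ≡ b + ((a + c) + d)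
  rearrange = solve-∀

-- Filling the occurrences of a variable moves size from the list of
-- substituted terms into the term, without creating any.
mutual
  fill-size : ∀ d s us →
    size (proj₁ (fill d s us)) + sizeBag (proj₂ (fill d s us)) ≤ size s + sizeBag us
  fill-size d (var n) us with n <ᵇ d | n ≡ᵇ d | us
  ... | true  | _     | us'     = ≤-refl
  ... | false | true  | []      = ≤-refl
  ... | false | true  | u ∷ us' rewrite size-lift 0 d u = n≤1+n _
  ... | false | false | us'     = ≤-refl
  fill-size d (lam s) us with fill (suc d) s us | fill-size (suc d) s us
  ... | s' , us' | ih = s≤s ih
  fill-size d (app s ts) us with fill d s us | fill-size d s us
  ... | s' , us₁ | ih₁ with fillBag d ts us₁ | fillBag-size d ts us₁
  ...   | ts' , us₂ | ih₂ = s≤s (chain {size s'} {sizeBag ts'} {size s} {sizeBag ts} ih₁ ih₂)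

  fillBag-size : ∀ d ts us →
    sizeBag (proj₁ (fillBag d ts us)) + sizeBag (proj₂ (fillBag d ts us)) ≤ sizeBag ts + sizeBag us
  fillBag-size d [] us = ≤-refl
  fillBag-size d (t ∷ ts) us with fill d t us | fill-size d t us
  ... | t' , us₁ | ih₁ with fillBag d ts us₁ | fillBag-size d ts us₁
  ...   | ts' , us₂ | ih₂ = chain {size t'} {sizeBag ts'} {size t} {sizeBag ts} ih₁ ih₂

  chain : ∀ {a b c d x y z : ℕ} → a + x ≤ c + y → b + z ≤ d + x → (a + b) + z ≤ (c + d) + y
  chain {a} {b} {c} {d} {x} {y} {z} p q = begin
    (a + b) + z ≡⟨ +-assoc a b z ⟩
    a + (b + z) ≤⟨ +-monoʳ-≤ a q ⟩
    a + (d + x) ≡⟨ swap₁ a d x ⟩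
    (a + x) + d ≤⟨ +-monoˡ-≤ d p ⟩
    (c + y) + d ≡⟨ swap₂ c y d ⟩
    (c + d) + y ∎
    where
    open ≤-Reasoning
    swap₁ : ∀ a d x → a + (d + x) ≡ (a + x) + d
    swap₁ = solve-∀
    swap₂ : ∀ c y d → (c + y) + d ≡ (c + d) + y
    swap₂ = solve-∀

insertions-size : ∀ x zs {π} → π ∈ insertions x zs → sizeBag π ≡ size x + sizeBag zs
insertions-size x [] (here refl) = refl
insertions-size x (y ∷ ys) (here refl) = refl
insertions-size x (y ∷ ys) (there π∈) with ∈-map⁻ (y ∷_) π∈
... | π' , π'∈ , refl = begin
  size y + sizeBag π'          ≡⟨ cong (size y +_) (insertions-size x ys π'∈) ⟩
  size y + (size x + sizeBag ys) ≡⟨ +-comm-middle (size y) (size x) (sizeBag ys) ⟩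
  size x + (size y + sizeBag ys) ∎
  where
  open ≡-Reasoning
  +-comm-middle : ∀ a b c → a + (b + c) ≡ b + (a + c)
  +-comm-middle = solve-∀

perms-size : ∀ us {π} → π ∈ perms us → sizeBag π ≡ sizeBag us
perms-size [] (here refl) = refl
perms-size (x ∷ xs) π∈ with ∈-concat⁻′ (map (insertions x) (perms xs)) π∈
... | ys , π∈ys , ys∈ with ∈-map⁻ (insertions x) ys∈
...   | ρ , ρ∈ , refl = trans (insertions-size x ρ π∈ys) (cong (size x +_) (perms-size xs ρ∈))

∂-smaller : ∀ a ts → All (λ t → size t < size (app (lam a) ts)) (∂ a ts)
∂-smaller a ts = if-nil (count 0 a ≡ᵇ length ts) (map⁺ (All.tabulate λ {π} → bound π))
  where
  if-nil : ∀ {P : RTerm → Set} {X} b → All P X → All P (if b then X else [])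
  if-nil true all = all
  if-nil false _ = []
  bound : ∀ π → π ∈ perms ts → size (proj₁ (fill 0 a π)) < size (app (lam a) ts)
  bound π π∈ = s≤s (begin
    size (proj₁ (fill 0 a π))                              ≤⟨ m≤m+n _ _ ⟩
    size (proj₁ (fill 0 a π)) + sizeBag (proj₂ (fill 0 a π)) ≤⟨ fill-size 0 a π ⟩
    size a + sizeBag π                                      ≡⟨ cong (size a +_) (perms-size ts π∈) ⟩
    size a + sizeBag ts                                     <⟨ +-monoˡ-< (sizeBag ts) (n<1+n _) ⟩
    suc (size a) + sizeBag ts                               ∎)
    where open ≤-Reasoning

_≺_ : RTerm → RTerm → Set
t ≺ s = ×-Lex _≡_ _<_ _<_ (size t , weight t) (size s , weight s)

≺-wellFounded : WellFounded _≺_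
≺-wellFounded = On.wellFounded (λ s → size s , weight s) (×-wellFounded <-wellFounded <-wellFounded)

record Monotone (C : RTerm → RTerm) : Set where
  field
    size-< : ∀ {a b} → size a < size b → size (C a) < size (C b)
    size-≡ : ∀ {a b} → size a ≡ size b → size (C a) ≡ size (C b)
    weight-< : ∀ {a b} → weight a < weight b → weight (C a) < weight (C b)

  ≺-mono : ∀ {a b} → a ≺ b → C a ≺ C b
  ≺-mono (inj₁ lt) = inj₁ (size-< lt)
  ≺-mono (inj₂ (eq , lt)) = inj₂ (size-≡ eq , weight-< lt)

lam-monotone : Monotone lam
lam-monotone = record { size-< = s≤s ; size-≡ = cong suc ; weight-< = s≤s }

head-monotone : ∀ ts → Monotone (λ s → app s ts)
head-monotone ts = record
  { size-< = λ lt → s≤s (+-monoˡ-< (sizeBag ts) lt)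
  ; size-≡ = cong (λ n → suc (n + sizeBag ts))
  ; weight-< = λ lt → s≤s (*-monoˡ-< (2 + weightBag ts) lt)
  }

bag-monotone : ∀ s ts₁ ts₂ → Monotone (λ t → app s (ts₁ ++ t ∷ ts₂))
bag-monotone s ts₁ ts₂ = record
  { size-< = λ {a} {b} lt → subst₂ _<_ (sym (size-in a)) (sym (size-in b))
               (s≤s (+-monoʳ-< (size s) (+-monoˡ-< (sizeBag ts₁ + sizeBag ts₂) lt)))
  ; size-≡ = λ {a} {b} eq → trans (size-in a)
               (trans (cong (λ n → suc (size s + (n + _))) eq) (sym (size-in b)))
  ; weight-< = λ {a} {b} lt → subst₂ _<_ (sym (weight-in a)) (sym (weight-in b))
               (s≤s (*-monoʳ-< (weight s) {{weight-nonZero s}}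
                 (s≤s (s≤s (+-monoˡ-< (weightBag ts₁ + weightBag ts₂) lt)))))
  }
  where
  size-in : ∀ t → size (app s (ts₁ ++ t ∷ ts₂)) ≡ suc (size s + (size t + (sizeBag ts₁ + sizeBag ts₂)))
  size-in t = cong (λ n → suc (size s + n)) (sizeBag-split ts₁ t ts₂)
  weight-in : ∀ t → weight (app s (ts₁ ++ t ∷ ts₂))
                    ≡ suc (weight s * (2 + (weight t + (weightBag ts₁ + weightBag ts₂))))
  weight-in t = cong (λ n → suc (weight s * (2 + n))) (weightBag-split ts₁ t ts₂)

σ-size : ∀ s ts qs →
  size (app (lam (app s (liftBag 0 1 qs))) ts) ≡ size (app (app (lam s) ts) qs)
σ-size s ts qs rewrite sizeBag-lift 0 1 qs = rearrange (size s) (sizeBag ts) (sizeBag qs)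
  where
  rearrange : ∀ a b c → suc (suc (suc (a + c)) + b) ≡ suc (suc (suc a + b) + c)
  rearrange = solve-∀

σ-weight : ∀ s ts qs →
  weight (app (lam (app s (liftBag 0 1 qs))) ts) < weight (app (app (lam s) ts) qs)
σ-weight s ts qs rewrite weightBag-lift 0 1 qs = inequality (weight s) (weightBag qs) (weightBag ts)
  where
  expand : ∀ a x y → suc (suc (suc a * (2 + y)) * (2 + x))
                     ≡ suc (suc (suc (a * (2 + x))) * (2 + y)) + (2 + x + (2 + y) * x)
  expand = solve-∀
  inequality : ∀ a x y → suc (suc (suc (a * (2 + x))) * (2 + y)) < suc (suc (suc a * (2 + y)) * (2 + x))
  inequality a x y = subst (suc (suc (suc (a * (2 + x))) * (2 + y)) <_) (sym (expand a x y)) (m<m+n (suc (suc (suc (a * (2 + x))) * (2 + y))) z<s)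

decreasing : ∀ {s S} → s ⇒ S → All (_≺ s) S
decreasing {app (lam a) ts} (∂β¬e _) = All.map inj₁ (∂-smaller a ts)
decreasing {app (app (lam s) ts) qs} ∂σ = inj₂ (σ-size s ts qs , σ-weight s ts qs) ∷ []
decreasing (ξlam r) = map⁺ (All.map (Monotone.≺-mono lam-monotone) (decreasing r))
decreasing {app _ ts} (ξappL r) = map⁺ (All.map (Monotone.≺-mono (head-monotone ts)) (decreasing r))
decreasing {app s _} (ξbag {ts₁ = ts₁} {ts₂ = ts₂} r) =
  map⁺ (All.map (Monotone.≺-mono (bag-monotone s ts₁ ts₂)) (decreasing r))

WN : RTerm → Set
WN s = Σ Sum λ S → ((s ∷ []) ⟶∂* S) × All NormalT S

WNSum : Sum → Set
WNSum S₀ = Σ Sum λ S → (S₀ ⟶∂* S) × All NormalT S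

wnSum : ∀ {S} → All WN S → WNSum S
wnSum [] = [] , ε , []
wnSum ((T₁ , r₁ , n₁) ∷ wns) with wnSum wns
... | T₂ , r₂ , n₂ = T₁ ++ T₂ , ⟶∂*-++ r₁ r₂ , ++⁺ n₁ n₂

wn-acc : ∀ s → Acc _≺_ s → WN s
wn-acc s (acc rs) with progress s
... | inj₂ normal = s ∷ [] , ε , normal ∷ []
... | inj₁ (S , r) with wnSum (All.map (λ t≺s → wn-acc _ (rs t≺s)) (decreasing r))
...   | S' , r' , normal = S' , single r ◅◅ r' , normal

wn : ∀ S → WNSum S
wn S = wnSum (All.tabulate λ {t} _ → wn-acc t (≺-wellFounded t))

-- Linearisation: the element of T(M) using every argument exactly once

lin : Λ → RTerm
lin (var n) = var n
lin (lam M) = lam (lin M)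
lin (app P Q) = app (lin P) (lin Q ∷ [])

lin∈T : ∀ M → lin M ∈T M
lin∈T (var n) = tvar
lin∈T (lam M) = tlam (lin∈T M)
lin∈T (app P Q) = tapp (lin∈T P) (lin∈T Q ∷ [])

lin-positive : ∀ M → Positive (lin M)
lin-positive (var n) = pvar
lin-positive (lam M) = plam (lin-positive M)
lin-positive (app P Q) = papp (lin-positive P) (lin-positive Q) []

count-lin : ∀ k M → count k (lin M) ≡ countΛ k M
count-lin k (var n) = refl
count-lin k (lam M) = count-lin (suc k) M
count-lin k (app P Q) = cong₂ _+_ (count-lin k P) (trans (+-identityʳ _) (count-lin k Q))

mutual
  lin-reflects-step : ∀ N {S} → lin N ⇒ S → Σ Λ (N ⟶ε_)
  lin-reflects-step (var n) ()
  lin-reflects-step (lam M) (ξlam r) = _ , ξlam (proj₂ (lin-reflects-step M r))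
  lin-reflects-step (app P Q) r = lin-reflects-appStep P Q r refl

  lin-reflects-appStep : ∀ P Q {x S} → x ⇒ S → x ≡ app (lin P) (lin Q ∷ []) → Σ Λ (app P Q ⟶ε_)
  lin-reflects-appStep (lam A) Q (∂β¬e c) refl = _ , β¬e (subst (0 <_) (count-lin 0 A) c)
  lin-reflects-appStep (app (lam A) B) C ∂σ refl = _ , σ
  lin-reflects-appStep P Q (ξappL r) refl = _ , ξappL (proj₂ (lin-reflects-step P r))
  lin-reflects-appStep P Q (ξbag {ts₁ = []} r) refl = _ , ξappR (proj₂ (lin-reflects-step Q r))
  lin-reflects-appStep P Q (ξbag {ts₁ = _ ∷ []} r) ()
  lin-reflects-appStep P Q (ξbag {ts₁ = _ ∷ _ ∷ _} r) ()

lin-normal : ∀ N → NormalΛ N → NormalT (lin N)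
lin-normal N normal S r = normal _ (proj₂ (lin-reflects-step N r))

-- Taylor expansion versus lifting and substitution

bool-cases : ∀ b → b ≡ true ⊎ b ≡ false
bool-cases true = inj₁ refl
bool-cases false = inj₂ refl

var∈T-inv : ∀ {t n} → t ∈T var n → t ≡ var n
var∈T-inv tvar = refl

module _ {d n : ℕ} where
  liftΛ-below : ∀ k → (n <ᵇ d) ≡ true → liftΛ d k (var n) ≡ var n
  liftΛ-below k e rewrite e = refl
  liftΛ-above : ∀ k → (n <ᵇ d) ≡ false → liftΛ d k (var n) ≡ var (n + k)
  liftΛ-above k e rewrite e = refl
  lift-below : ∀ k → (n <ᵇ d) ≡ true → lift d k (var n) ≡ var n
  lift-below k e rewrite e = refl
  lift-above : ∀ k → (n <ᵇ d) ≡ false → lift d k (var n) ≡ var (n + k)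
  lift-above k e rewrite e = refl
  substΛ-below : ∀ N → (n <ᵇ d) ≡ true → substΛ d N (var n) ≡ var n
  substΛ-below N e rewrite e = refl
  substΛ-here : ∀ N → (n <ᵇ d) ≡ false → (n ≡ᵇ d) ≡ true → substΛ d N (var n) ≡ liftΛ 0 d N
  substΛ-here N e₁ e₂ rewrite e₁ | e₂ = refl
  substΛ-above : ∀ N → (n <ᵇ d) ≡ false → (n ≡ᵇ d) ≡ false → substΛ d N (var n) ≡ var (n ∸ 1)
  substΛ-above N e₁ e₂ rewrite e₁ | e₂ = refl
  fill-below : ∀ us → (n <ᵇ d) ≡ true → fill d (var n) us ≡ (var n , us)
  fill-below us e rewrite e = refl
  fill-here : ∀ u us → (n <ᵇ d) ≡ false → (n ≡ᵇ d) ≡ true → fill d (var n) (u ∷ us) ≡ (lift 0 d u , us)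
  fill-here u us e₁ e₂ rewrite e₁ | e₂ = refl
  fill-above : ∀ us → (n <ᵇ d) ≡ false → (n ≡ᵇ d) ≡ false → fill d (var n) us ≡ (var (n ∸ 1) , us)
  fill-above us e₁ e₂ rewrite e₁ | e₂ = refl
  count-here : (n ≡ᵇ d) ≡ true → count d (var n) ≡ 1
  count-here e rewrite e = refl
  count-other : (n ≡ᵇ d) ≡ false → count d (var n) ≡ 0
  count-other e rewrite e = refl
  below-not-here : (n <ᵇ d) ≡ true → (n ≡ᵇ d) ≡ true → ⊥
  below-not-here e₁ e₂ =
    <-irrefl (≡ᵇ⇒≡ n d (subst T (sym e₂) tt)) (<ᵇ⇒< n d (subst T (sym e₁) tt))

mutual
  lift∈T-inv : ∀ c d C {t'} → t' ∈T liftΛ c d C → Σ RTerm λ t → t ∈T C × lift c d t ≡ t'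
  lift∈T-inv c d (var n) {t'} h with bool-cases (n <ᵇ c)
  ... | inj₁ e = var n , tvar ,
        trans (lift-below {c} {n} d e) (sym (var∈T-inv (subst (t' ∈T_) (liftΛ-below {c} {n} d e) h)))
  ... | inj₂ e = var n , tvar ,
        trans (lift-above {c} {n} d e) (sym (var∈T-inv (subst (t' ∈T_) (liftΛ-above {c} {n} d e) h)))
  lift∈T-inv c d (lam C) (tlam h) with lift∈T-inv (suc c) d C h
  ... | t , t∈ , refl = lam t , tlam t∈ , refl
  lift∈T-inv c d (app P Q) (tapp h hs) with lift∈T-inv c d P h | liftBag∈T-inv c d Q hs
  ... | t , t∈ , refl | ts , ts∈ , refl = app t ts , tapp t∈ ts∈ , refl

  liftBag∈T-inv : ∀ c d C {ts'} → All (_∈T liftΛ c d C) ts' →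
                  Σ Bag λ ts → All (_∈T C) ts × liftBag c d ts ≡ ts'
  liftBag∈T-inv c d C [] = [] , [] , refl
  liftBag∈T-inv c d C (h ∷ hs) with lift∈T-inv c d C h | liftBag∈T-inv c d C hs
  ... | t , t∈ , refl | ts , ts∈ , refl = t ∷ ts , t∈ ∷ ts∈ , refl

mutual
  lift-positive : ∀ c d t → Positive (lift c d t) → Positive t
  lift-positive c d (var n) p = pvar
  lift-positive c d (lam t) (plam p) = plam (lift-positive (suc c) d t p)
  lift-positive c d (app t []) ()
  lift-positive c d (app t (u ∷ us)) (papp p pu pus) =
    papp (lift-positive c d t p) (lift-positive c d u pu) (liftBag-positive c d us pus)

  liftBag-positive : ∀ c d ts → All Positive (liftBag c d ts) → All Positive ts
  liftBag-positive c d [] _ = []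
  liftBag-positive c d (t ∷ ts) (p ∷ ps) = lift-positive c d t p ∷ liftBag-positive c d ts ps

-- A positive element of T(A) has at least as many occurrences of each
-- variable as A itself (every bag contains at least one copy).
count-positive : ∀ {a A} → a ∈T A → Positive a → ∀ k → countΛ k A ≤ count k a
count-positive tvar p k = ≤-refl
count-positive (tlam h) (plam p) k = count-positive h p (suc k)
count-positive (tapp h (h₁ ∷ hs)) (papp p p₁ ps) k =
  +-mono-≤ (count-positive h p k) (≤-trans (count-positive h₁ p₁ k) (m≤m+n _ _))

fill-lam : ∀ {d a xs b r} → fill (suc d) a xs ≡ (b , r) → fill d (lam a) xs ≡ (lam b , r)
fill-lam e rewrite e = refl

fill-app : ∀ {d a as xs b r₁ bs r₂} → fill d a xs ≡ (b , r₁) → fillBag d as r₁ ≡ (bs , r₂) →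
           fill d (app a as) xs ≡ (app b bs , r₂)
fill-app e₁ e₂ rewrite e₁ | e₂ = refl

fill-cons : ∀ {d a as xs b r₁ bs r₂} → fill d a xs ≡ (b , r₁) → fillBag d as r₁ ≡ (bs , r₂) →
            fillBag d (a ∷ as) xs ≡ (b ∷ bs , r₂)
fill-cons e₁ e₂ rewrite e₁ | e₂ = refl

-- A positive t' ∈ T(A[N/d]) is a[us/d] for a positive a ∈ T(A) and a bag us
-- of positive elements of T(N), one for each occurrence of d in a; filling a
-- consumes exactly the prefix us of any list of terms.
record Decomposition (d : ℕ) (N A : Λ) (t' : RTerm) : Set where
  constructor decomposition
  field
    a : RTerm
    us : Bag
    a∈T : a ∈T A
    us∈T : All (_∈T N) us
    a-positive : Positive a
    us-positive : All Positive us
    count≡ : count d a ≡ length us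
    fills : ∀ rest → fill d a (us ++ rest) ≡ (t' , rest)

record BagDecomposition (d : ℕ) (N Q : Λ) (ts' : Bag) : Set where
  constructor bagDecomposition
  field
    bs : Bag
    vs : Bag
    bs∈T : All (_∈T Q) bs
    vs∈T : All (_∈T N) vs
    bs-positive : All Positive bs
    vs-positive : All Positive vs
    count≡ : countBag d bs ≡ length vs
    fills : ∀ rest → fillBag d bs (vs ++ rest) ≡ (ts' , rest)

module _ {d : ℕ} {N : Λ} where

  decompose-var : ∀ n {t'} → t' ∈T substΛ d N (var n) → Positive t' → Decomposition d N (var n) t'
  decompose-var n {t'} h p with bool-cases (n <ᵇ d) | bool-cases (n ≡ᵇ d)
  ... | inj₁ below | inj₁ at = ⊥-elim (below-not-here {d} {n} below at)
  ... | inj₁ below | inj₂ other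
    with refl ← var∈T-inv (subst (t' ∈T_) (substΛ-below {d} {n} N below) h) =
    decomposition (var n) [] tvar [] pvar [] (count-other {d} {n} other) (λ rest → fill-below {d} {n} rest below)
  ... | inj₂ above | inj₂ other
    with refl ← var∈T-inv (subst (t' ∈T_) (substΛ-above {d} {n} N above other) h) =
    decomposition (var n) [] tvar [] pvar [] (count-other {d} {n} other) (λ rest → fill-above {d} {n} rest above other)
  ... | inj₂ above | inj₁ at
    with u , u∈T , refl ← lift∈T-inv 0 d N (subst (t' ∈T_) (substΛ-here {d} {n} N above at) h) =
    decomposition (var n) (u ∷ []) tvar (u∈T ∷ []) pvar (lift-positive 0 d u p ∷ [])
      (count-here {d} {n} at) (λ rest → fill-here {d} {n} u rest above at)

  decompose-lam : ∀ {A t'} → Decomposition (suc d) N A t' → Decomposition d N (lam A) (lam t')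
  decompose-lam (decomposition a us a∈T us∈T pa pus count≡ fills) =
    decomposition (lam a) us (tlam a∈T) us∈T (plam pa) pus count≡ (λ rest → fill-lam {d} {a} {us ++ rest} (fills rest))

  decompose-cons : ∀ {Q t' ts'} → Decomposition d N Q t' → BagDecomposition d N Q ts' →
                   BagDecomposition d N Q (t' ∷ ts')
  decompose-cons (decomposition a us a∈T us∈T pa pus count≡ fills)
                 (bagDecomposition bs vs bs∈T vs∈T pbs pvs count≡' fills') =
    bagDecomposition (a ∷ bs) (us ++ vs) (a∈T ∷ bs∈T) (++⁺ us∈T vs∈T) (pa ∷ pbs) (++⁺ pus pvs)
      (trans (cong₂ _+_ count≡ count≡') (sym (length-++ us)))
      (λ rest → subst (λ xs → fillBag d (a ∷ bs) xs ≡ _) (sym (++-assoc us vs rest))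
                  (fill-cons {d} {a} {bs} {us ++ (vs ++ rest)} (fills (vs ++ rest)) (fills' rest)))

  -- The argument bag is nonempty, as the result is a positive application.
  decompose-app : ∀ {P Q t' u' us'} → Decomposition d N P t' → Decomposition d N Q u' →
                  BagDecomposition d N Q us' → Decomposition d N (app P Q) (app t' (u' ∷ us'))
  decompose-app (decomposition a us a∈T us∈T pa pus count≡ fills) head tail =
    decomposition (app a bs) (us ++ vs) (tapp a∈T bs∈T) (++⁺ us∈T vs∈T)
      (papp pa (Decomposition.a-positive head) (BagDecomposition.bs-positive tail)) (++⁺ pus vs-positive)
      (trans (cong₂ _+_ count≡ count≡') (sym (length-++ us)))
      (λ rest → subst (λ xs → fill d (app a bs) xs ≡ _) (sym (++-assoc us vs rest))
                  (fill-app {d} {a} {bs} {us ++ (vs ++ rest)} (fills (vs ++ rest)) (fills' rest)))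
    where open BagDecomposition (decompose-cons head tail) renaming (count≡ to count≡'; fills to fills')

mutual
  decompose : ∀ d N A {t'} → t' ∈T substΛ d N A → Positive t' → Decomposition d N A t'
  decompose d N (var n) h p = decompose-var n h p
  decompose d N (lam A) (tlam h) (plam p) = decompose-lam (decompose (suc d) N A h p)
  decompose d N (app P Q) (tapp h (h₁ ∷ hs)) (papp p p₁ ps) =
    decompose-app (decompose d N P h p) (decompose d N Q h₁ p₁) (decomposeBag d N Q hs ps)

  decomposeBag : ∀ d N Q {ts'} → All (_∈T substΛ d N Q) ts' → All Positive ts' →
                 BagDecomposition d N Q ts'
  decomposeBag d N Q [] [] = bagDecomposition [] [] [] [] [] [] refl (λ rest → refl)
  decomposeBag d N Q (h ∷ hs) (p ∷ ps) = decompose-cons (decompose d N Q h p) (decomposeBag d N Q hs ps)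

-- Anti-reduction of positive elements of the Taylor expansion

perms-self : ∀ {A : Set} (xs : List A) → xs ∈ perms xs
perms-self [] = here refl
perms-self (x ∷ xs) = ∈-concat⁺′ (insert-front xs) (∈-map⁺ (insertions x) (perms-self xs))
  where
  insert-front : ∀ ys → (x ∷ ys) ∈ insertions x ys
  insert-front [] = here refl
  insert-front (y ∷ ys) = here refl

fill∈∂ : ∀ a us → count 0 a ≡ length us → proj₁ (fill 0 a us) ∈ ∂ a us
fill∈∂ a us count≡ = subst (proj₁ (fill 0 a us) ∈_) (sym ∂≡) (∈-map⁺ (λ π → proj₁ (fill 0 a π)) (perms-self us))
  where
  counts-agree : (count 0 a ≡ᵇ length us) ≡ true
  counts-agree = trans (cong (_≡ᵇ length us) count≡)
                   (Equivalence.to T-≡ (≡⇒≡ᵇ (length us) (length us) refl))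
  ∂≡ : ∂ a us ≡ map (λ π → proj₁ (fill 0 a π)) (perms us)
  ∂≡ = cong (λ b → if b then map (λ π → proj₁ (fill 0 a π)) (perms us) else []) counts-agree

AntiReduct : Λ → RTerm → Set
AntiReduct M t' = Σ RTerm λ t → t ∈T M × Positive t × Reach t t'

BagReach : Bag → Bag → Set
BagReach ts ts' = ∀ f pre → Reach (app f (pre ++ ts)) (app f (pre ++ ts'))

BagAntiReduct : Λ → Bag → Set
BagAntiReduct Q ts' = Σ Bag λ ts → All (_∈T Q) ts × All Positive ts × BagReach ts ts'

bagReach-cons : ∀ {u u' us us'} → Reach u u' → BagReach us us' → BagReach (u ∷ us) (u' ∷ us')
bagReach-cons {u} {u'} {us} {us'} R Rs f pre =
  reach-trans (reach-map {λ x → app f (pre ++ x ∷ us)} ξbag R)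
    (subst₂ Reach (cong (app f) (++-assoc pre (u' ∷ []) us)) (cong (app f) (++-assoc pre (u' ∷ []) us'))
      (Rs f (pre ++ u' ∷ [])))

-- β-steps: decompose the positive t' ∈ T(A[N/x]) as a[us/x]; the bag us is
-- nonempty since x occurs in A, and ⟨λx.a⟩us reduces to a sum containing t'.
antiReduct-β : ∀ A N {t'} → 0 < countΛ 0 A → t' ∈T substΛ 0 N A → Positive t' →
               AntiReduct (app (lam A) N) t'
antiReduct-β A N {t'} occurs h p with decompose 0 N A h p
... | decomposition a [] a∈T _ pa _ count≡ _ =
  ⊥-elim (<-irrefl (sym count≡) (<-≤-trans occurs (count-positive a∈T pa 0)))
... | decomposition a (u ∷ us) a∈T us∈T pa (pu ∷ pus) count≡ fills =
  app (lam a) (u ∷ us) , tapp (tlam a∈T) us∈T , papp (plam pa) pu pus ,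
  (∂ a (u ∷ us) , single (∂β¬e (<-≤-trans occurs (count-positive a∈T pa 0))) ,
   subst (_∈ ∂ a (u ∷ us)) filled (fill∈∂ a (u ∷ us) count≡))
  where
  filled : proj₁ (fill 0 a (u ∷ us)) ≡ t'
  filled = cong proj₁ (subst (λ xs → fill 0 a xs ≡ (t' , [])) (++-identityʳ (u ∷ us)) (fills []))

-- σ-steps: t' = ⟨λx.⟨a⟩cs'⟩bs where cs' lifts a bag cs of elements of T(C),
-- and ⟨⟨λx.a⟩bs⟩cs σ-reduces to t'.
antiReduct-σ : ∀ A B C {t'} → t' ∈T app (lam (app A (liftΛ 0 1 C))) B → Positive t' →
               AntiReduct (app (app (lam A) B) C) t'
antiReduct-σ A B C (tapp (tlam (tapp a∈T cs'∈T)) bs∈T) (papp (plam (papp pa pc pcs)) pb pbs)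
  with liftBag∈T-inv 0 1 C cs'∈T
... | [] , _ , ()
... | c ∷ cs , cs∈T , refl with liftBag-positive 0 1 (c ∷ cs) (pc ∷ pcs)
...   | pc' ∷ pcs' =
  app (app (lam _) _) (c ∷ cs) , tapp (tapp (tlam a∈T) bs∈T) cs∈T ,
  papp (papp (plam pa) pb pbs) pc' pcs' , (_ , single ∂σ , here refl)

mutual
  antiReduct : ∀ {M M' t'} → M ⟶ε M' → t' ∈T M' → Positive t' → AntiReduct M t'
  antiReduct {app (lam A) N} (β¬e occurs) h p = antiReduct-β A N occurs h p
  antiReduct {app (app (lam A) B) C} σ h p = antiReduct-σ A B C h p
  antiReduct (ξlam r) (tlam h) (plam p) with antiReduct r h p
  ... | t , t∈T , pt , R = lam t , tlam t∈T , plam pt , reach-map ξlam R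
  antiReduct (ξappL r) (tapp h hs) (papp p pu pus) with antiReduct r h p
  ... | t , t∈T , pt , R = app t _ , tapp t∈T hs , papp pt pu pus , reach-map ξappL R
  antiReduct (ξappR r) (tapp {s = f} h (h₁ ∷ hs)) (papp p pu pus)
    with antiReduct r h₁ pu | antiReductBag r hs pus
  ... | u , u∈T , pu' , R | us , us∈T , pus' , Rs =
    app f (u ∷ us) , tapp h (u∈T ∷ us∈T) , papp p pu' pus' , bagReach-cons R Rs f []

  antiReductBag : ∀ {Q Q' ts'} → Q ⟶ε Q' → All (_∈T Q') ts' → All Positive ts' →
                  BagAntiReduct Q ts'
  antiReductBag r [] [] = [] , [] , [] , λ f pre → reach-refl
  antiReductBag r (h ∷ hs) (p ∷ ps) with antiReduct r h p | antiReductBag r hs ps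
  ... | u , u∈T , pu , R | us , us∈T , pus , Rs = u ∷ us , u∈T ∷ us∈T , pu ∷ pus , bagReach-cons R Rs

antiReduct* : ∀ {M N t'} → M ⟶ε* N → t' ∈T N → Positive t' → AntiReduct M t'
antiReduct* ε h p = _ , h , p , reach-refl
antiReduct* (r ◅ rs) h p with antiReduct* rs h p
... | t , t∈T , pt , R with antiReduct r t∈T pt
...   | s , s∈T , ps , R' = s , s∈T , ps , reach-trans R' R

-- If t reduces to a sum containing a normal positive term p, then its normal
-- form contains p: normalise the other summands around p.
reach-normal-positive : ∀ {t p} → Reach t p → NormalT p → Positive p → NFHasPositive t
reach-normal-positive {p = p} (S , t⟶*S , p∈S) p-normal p-positive with ∈-∃++ p∈S
... | A , B , refl with wn A | wn B
...   | A' , A⟶*A' , A'-normal | B' , B⟶*B' , B'-normal =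
  A' ++ p ∷ B' ,
  t⟶*S ◅◅ ⟶∂*-++ A⟶*A' (⟶∂*-++ (ε {x = p ∷ []}) B⟶*B') ,
  normalSum (++⁺ A'-normal (p-normal ∷ B'-normal)) ,
  p , ∈-++⁺ʳ A' (here refl) , p-positive

-- Pull the linearisation of the normal form N back along M ⟶ε* N.
mainTheorem18 : (M : Λ) → Normalizable M → Σ RTerm λ s → s ∈T M × NFHasPositive s
mainTheorem18 M (N , M⟶*N , N-normal) with antiReduct* M⟶*N (lin∈T N) (lin-positive N)
... | s , s∈T , _ , s-reaches-linN =
  s , s∈T , reach-normal-positive s-reaches-linN (lin-normal N N-normal) (lin-positive N)
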